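{- Let $k \geq 2$ and let $G$ be a complete $k$-partite graph (with all parts nonempty) that is not the complete graph $K_k$. Then $\mathrm{lir}(G) \leq 2$, i.e., the edges of $G$ can be colored with at most two colors so that each color class induces a locally irregular subgraph.
   Context: A graph is locally irregular if the two endvertices of every edge have different degrees. A locally irregular edge coloring of $G$ is an edge coloring in which every color class induces a locally irregular subgraph; $\mathrm{lir}(G)$ is the minimum number of colors in such a coloring. -}

module Defs where

open import Data.Nat using (ℕ)
open import Data.Fin using (Fin; _≟_)
open import Data.List using (List; length; filter)
open import Data.Fin.Base using ()
open import Data.List.Base using ()
open import Data.Fin.Properties using ()
open import Data.Product using (_×_; Σ; ∃)
open import Relation.Nullary using (¬_; Dec; yes; no)
open import Relation.Nullary.Decidable using (_×-dec_; ¬?)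
open import Relation.Binary.PropositionalEquality using (_≡_; _≢_)
open import Function.Definitions using (Surjective; Injective)
import Data.List as L

record Graph (n : ℕ) : Set₁ where
  field
    Adj    : Fin n → Fin n → Set
    adj?   : ∀ u v → Dec (Adj u v)
    sym    : ∀ {u v} → Adj u v → Adj v u
    irrefl : ∀ {u} → ¬ Adj u u
open Graph public

completeMultipartite : ∀ {n k} → (Fin n → Fin k) → Graph n
completeMultipartite p = record
  { Adj    = λ u v → p u ≢ p v
  ; adj?   = λ u v → ¬? (p u ≟ p v)
  ; sym    = λ ne eq → ne (Relation.Binary.PropositionalEquality.sym eq)
  ; irrefl = λ ne → ne Relation.Binary.PropositionalEquality.refl
  }

record EdgeColoring {n : ℕ} (G : Graph n) (m : ℕ) : Set where
  field
    col    : Fin n → Fin n → Fin m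
    col-sym : ∀ u v → Adj G u v → col u v ≡ col v u
open EdgeColoring public

colorDegree : ∀ {n m} {G : Graph n} → EdgeColoring G m → Fin m → Fin n → ℕ
colorDegree {n} {G = G} c a u =
  length (filter (λ w → adj? G u w ×-dec (col c u w ≟ a)) (L.allFin n))

LocallyIrregular : ∀ {n m} {G : Graph n} → EdgeColoring G m → Set
LocallyIrregular {G = G} c =
  ∀ u v → Adj G u v → colorDegree c (col c u v) u ≢ colorDegree c (col c u v) v

lirAtMost : ∀ {n} → Graph n → ℕ → Set
lirAtMost G m = Σ (EdgeColoring G m) LocallyIrregular

-- Order the parts by size, ties broken by index, and give every edge the colour of its
-- endpoint in the smaller part. A vertex is coloured by the parity of the number of vertices
-- in smaller parts, flipped at one representative of its part. Then every part with two
-- vertices carries both colours, and between two singleton parts of equal colour lies a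
-- vertex of the other colour.
-- For an edge uv of colour c, with u in the smaller part α and v in β, everything v sees
-- along c, together with (H) the vertices of β and, when v itself is not coloured c, those
-- above β, and (M) the vertices strictly between α and β not coloured c, is seen by u along c
-- or is one of the vertices (A) of α coloured c. So v has the smaller c-degree once A < H + M,
-- which the two properties above and a part of size two (the graph is not complete) ensure.

module Submission where

open import Defs hiding (sym)
open import Data.Nat using (ℕ; _≥_)
open import Data.Fin using (Fin)
open import Relation.Nullary using (¬_)
open import Function.Definitions using (Surjective; Injective)
open import Relation.Binary.PropositionalEquality using (_≡_)

open import Data.Bool using (true; false; if_then_else_)
open import Data.Empty using (⊥-elim)
open import Data.Fin using (zero; suc; toℕ)
open import Data.Fin.Properties using (_≟_; any?; toℕ-injective)
open import Data.List using (length; filter; tabulate)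
open import Data.Nat using (zero; suc; _+_; _≤_; _<_; _≤?_; z≤n; s≤s; parity)
open import Data.Nat.Induction using (<-wellFounded)
open import Data.Nat.Properties
  using (≤-refl; ≤-reflexive; ≤-trans; ≤-antisym; <-irrefl; <⇒≤; >⇒≢; <-≤-trans; ≤-<-trans; ≰⇒>;
         m≤m+n; +-mono-≤; +-mono-<-≤; +-mono-≤-<; <-strictTotalOrder; +-0-commutativeMonoid;
         module ≤-Reasoning)
open import Data.Parity using (Parity; 0ℙ; 1ℙ; _⁻¹)
open import Data.Parity.Properties as ℙ using (p≢p⁻¹; ⁻¹-injective; suc-homo-⁻¹)
open import Data.Product using (_×_; _,_; proj₁; proj₂; ∃-syntax)
open import Data.Product.Relation.Binary.Lex.Strict using (×-strictTotalOrder; ×-wellFounded)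
open import Data.Sum using (_⊎_; inj₁; inj₂)
open import Function using (_∘_; _on_; case_of_)
open import Induction.WellFounded using (Acc; acc; WellFounded)
open import Level using (Level; 0ℓ)
open import Relation.Binary using (Rel; StrictTotalOrder; Trichotomous; tri<; tri≈; tri>)
import Relation.Binary.Construct.On as On
open import Relation.Binary.PropositionalEquality
  using (_≢_; ≢-sym; refl; sym; trans; cong; cong₂; subst)
open import Relation.Nullary using (Dec; yes; no; does)
open import Relation.Nullary.Decidable using (_⊎-dec_; _×-dec_; ¬?; decidable-stable)
open import Relation.Nullary.Negation using (contradiction)
open import Relation.Unary using (Pred; Decidable; _⊆_; _≐_; _∈_; _∉_; _∪_; _⊥_; ｛_｝)
open import Relation.Unary.Properties using (_∪?_)
open import Algebra.Properties.CommutativeMonoid.Sum +-0-commutativeMonoid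
  using (sum; sum-cong-≗; ∑-distrib-+; sum-replicate-zero)

private variable
  ℓ ℓ′ : Level
  n : ℕ
  X Y : Set ℓ

𝟙 : Dec X → ℕ
𝟙 X? = if does X? then 1 else 0

𝟙-mono : (X? : Dec X) (Y? : Dec Y) → (X → Y) → 𝟙 X? ≤ 𝟙 Y?
𝟙-mono (yes _) (yes _) _ = ≤-refl
𝟙-mono (yes a) (no ¬b) f = contradiction (f a) ¬b
𝟙-mono (no _) _ _ = z≤n

𝟙-< : (X? : Dec X) (Y? : Dec Y) → ¬ X → Y → 𝟙 X? < 𝟙 Y?
𝟙-< (yes a) _ ¬a _ = contradiction a ¬a
𝟙-< (no _) (yes _) _ _ = s≤s z≤n
𝟙-< (no _) (no ¬b) _ b = contradiction b ¬b

𝟙-⊎ : (X? : Dec X) (Y? : Dec Y) → (X → ¬ Y) → 𝟙 (X? ⊎-dec Y?) ≡ 𝟙 X? + 𝟙 Y?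
𝟙-⊎ (yes a) (yes b) disjoint = contradiction b (disjoint a)
𝟙-⊎ (yes _) (no _) _ = refl
𝟙-⊎ (no _) (yes _) _ = refl
𝟙-⊎ (no _) (no _) _ = refl

sum-mono : {f g : Fin n → ℕ} → (∀ i → f i ≤ g i) → sum f ≤ sum g
sum-mono {zero} _ = z≤n
sum-mono {suc n} f≤g = +-mono-≤ (f≤g zero) (sum-mono (f≤g ∘ suc))

sum-< : {f g : Fin n → ℕ} → (∀ i → f i ≤ g i) → ∀ i → f i < g i → sum f < sum g
sum-< f≤g zero f<g = +-mono-<-≤ f<g (sum-mono (f≤g ∘ suc))
sum-< f≤g (suc i) f<g = +-mono-≤-< (f≤g zero) (sum-< (f≤g ∘ suc) i f<g)

count : {P : Pred (Fin n) ℓ} → Decidable P → ℕ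
count P? = sum (λ i → 𝟙 (P? i))

module _ {P : Pred (Fin n) ℓ} {Q : Pred (Fin n) ℓ′} (P? : Decidable P) (Q? : Decidable Q) where

  count-mono : P ⊆ Q → count P? ≤ count Q?
  count-mono P⊆Q = sum-mono (λ i → 𝟙-mono (P? i) (Q? i) P⊆Q)

  count-< : P ⊆ Q → ∀ {i} → i ∉ P → i ∈ Q → count P? < count Q?
  count-< P⊆Q {i} i∉P i∈Q = sum-< (λ j → 𝟙-mono (P? j) (Q? j) P⊆Q) i (𝟙-< (P? i) (Q? i) i∉P i∈Q)

  count-∪ : P ⊥ Q → count (P? ∪? Q?) ≡ count P? + count Q?
  count-∪ P⊥Q = trans (sum-cong-≗ (λ i → 𝟙-⊎ (P? i) (Q? i) (λ p q → P⊥Q (p , q))))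
                      (∑-distrib-+ (λ i → 𝟙 (P? i)) (λ i → 𝟙 (Q? i)))

count-singleton : (x : Fin n) → count (x ≟_) ≡ 1
count-singleton {suc n} zero = cong suc (sum-replicate-zero n)
count-singleton (suc x) = count-singleton x

count-cong : {P : Pred (Fin n) ℓ} {Q : Pred (Fin n) ℓ′} (P? : Decidable P) (Q? : Decidable Q) →
             P ≐ Q → count P? ≡ count Q?
count-cong P? Q? (P⊆Q , Q⊆P) = ≤-antisym (count-mono P? Q? P⊆Q) (count-mono Q? P? Q⊆P)

module _ {P : Pred (Fin n) ℓ} (P? : Decidable P) where

  count-≥1 : ∀ {x} → x ∈ P → 1 ≤ count P?
  count-≥1 {x} x∈P = subst (_≤ count P?) (count-singleton x)
    (count-mono (x ≟_) P? (λ { refl → x∈P }))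

  count-≥2 : ∀ {x y} → x ≢ y → x ∈ P → y ∈ P → 2 ≤ count P?
  count-≥2 {x} {y} x≢y x∈P y∈P =
    subst (_≤ count P?) (trans (count-∪ (x ≟_) (y ≟_) (λ { (refl , refl) → x≢y refl }))
                               (cong₂ _+_ (count-singleton x) (count-singleton y)))
      (count-mono ((x ≟_) ∪? (y ≟_)) P? λ { (inj₁ refl) → x∈P ; (inj₂ refl) → y∈P })

  count-≤1 : ∀ {x} → P ⊆ ｛ x ｝ → count P? ≤ 1
  count-≤1 {x} P⊆x = subst (count P? ≤_) (count-singleton x) (count-mono P? (x ≟_) P⊆x)

length-filter-tabulate : {P : Pred X ℓ} (P? : Decidable P) (f : Fin n → X) →
  length (filter P? (tabulate f)) ≡ sum (λ i → 𝟙 (P? (f i)))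
length-filter-tabulate {n = zero} P? f = refl
length-filter-tabulate {n = suc n} P? f with does (P? (f zero))
... | true = cong suc (length-filter-tabulate P? (f ∘ suc))
... | false = length-filter-tabulate P? (f ∘ suc)

flipIf : Dec X → Parity → Parity
flipIf (yes _) q = q ⁻¹
flipIf (no _) q = q

toFin : Parity → Fin 2
toFin 0ℙ = zero
toFin 1ℙ = suc zero

toFin-injective : ∀ {q r} → toFin q ≡ toFin r → q ≡ r
toFin-injective {0ℙ} {0ℙ} _ = refl
toFin-injective {1ℙ} {1ℙ} _ = refl

parity-suc : ∀ m → parity (suc m) ≢ parity m
parity-suc m eq = p≢p⁻¹ (parity (suc m)) (trans eq (sym (suc-homo-⁻¹ m)))

module PartOrder {k} (p : Fin n → Fin k) where

  size : Fin k → ℕ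
  size α = count (λ w → p w ≟ α)

  private
    module Lex = StrictTotalOrder (×-strictTotalOrder <-strictTotalOrder <-strictTotalOrder)

    key : Fin k → ℕ × ℕ
    key α = size α , toℕ α

  _≺_ : Rel (Fin k) 0ℓ
  _≺_ = Lex._<_ on key

  _≺?_ : ∀ α β → Dec (α ≺ β)
  α ≺? β = key α Lex.<? key β

  ≺-trans : ∀ {α β γ} → α ≺ β → β ≺ γ → α ≺ γ
  ≺-trans = Lex.trans

  ≺-asym : ∀ {α β} → α ≺ β → ¬ β ≺ α
  ≺-asym = Lex.asym

  ≺-irrefl : ∀ {α} → ¬ α ≺ α
  ≺-irrefl = Lex.irrefl (refl , refl)

  ≺⇒≢ : ∀ {α β} → α ≺ β → α ≢ β
  ≺⇒≢ α≺β refl = ≺-irrefl α≺β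

  ≺-compare : Trichotomous _≡_ _≺_
  ≺-compare α β with Lex.compare (key α) (key β)
  ... | tri< lt _ _ = tri< lt (≺⇒≢ lt) (≺-asym lt)
  ... | tri> _ _ gt = tri> (≺-asym gt) (≺⇒≢ gt ∘ sym) gt
  ... | tri≈ _ (_ , eq) _ = tri≈ (≺-irrefl ∘ subst (_≺ β) α≡β) α≡β (≺-irrefl ∘ subst (β ≺_) α≡β)
    where α≡β = toℕ-injective eq

  ≺-wellFounded : WellFounded _≺_
  ≺-wellFounded = On.wellFounded key (×-wellFounded <-wellFounded <-wellFounded)

  size-mono : ∀ {α β} → α ≺ β → size α ≤ size β
  size-mono (inj₁ lt) = <⇒≤ lt
  size-mono (inj₂ (eq , _)) = ≤-reflexive eq


module Construction {k} (p : Fin n → Fin k) (rep : Fin k → Fin n) (p∘rep : ∀ α → p (rep α) ≡ α) where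

  open PartOrder p

  below : Fin k → ℕ
  below α = count (λ w → p w ≺? α)

  χ : Fin n → Parity
  χ u = flipIf (u ≟ rep (p u)) (parity (below (p u)))

  χ-rep : ∀ α → χ (rep α) ≡ parity (below α) ⁻¹
  χ-rep α with rep α ≟ rep (p (rep α))
  ... | yes _ = cong (λ β → parity (below β) ⁻¹) (p∘rep α)
  ... | no not-rep = contradiction (cong rep (sym (p∘rep α))) not-rep

  χ-nonrep : ∀ {w α} → p w ≡ α → w ≢ rep α → χ w ≡ parity (below α)
  χ-nonrep {w} refl w≢rep with w ≟ rep (p w)
  ... | yes ≡rep = contradiction ≡rep w≢rep
  ... | no _ = refl

  monochromatic⇒singleton : ∀ {α c} → (∀ {w} → p w ≡ α → χ w ≡ c) → size α ≡ 1
  monochromatic⇒singleton {α} mono =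
    ≤-antisym (count-≤1 (λ w → p w ≟ α) only-rep) (count-≥1 (λ w → p w ≟ α) (p∘rep α))
    where
    only-rep : ∀ {w} → p w ≡ α → rep α ≡ w
    only-rep {w} pw≡α with w ≟ rep α
    ... | yes w≡rep = sym w≡rep
    ... | no w≢rep = contradiction
      (trans (sym (χ-nonrep pw≡α w≢rep)) (trans (mono pw≡α) (trans (sym (mono (p∘rep α))) (χ-rep α))))
      (p≢p⁻¹ _)

  singleton⇒rep : ∀ {α w} → size α ≡ 1 → p w ≡ α → w ≡ rep α
  singleton⇒rep {α} {w} size≡1 pw≡α with w ≟ rep α
  ... | yes w≡rep = w≡rep
  ... | no w≢rep =
    contradiction (subst (2 ≤_) size≡1 (count-≥2 (λ v → p v ≟ α) w≢rep pw≡α (p∘rep α))) λ { (s≤s ()) }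

  χ-singleton : ∀ {w} → size (p w) ≡ 1 → χ w ≡ parity (below (p w)) ⁻¹
  χ-singleton {w} size≡1 = trans (cong χ (singleton⇒rep size≡1 refl)) (χ-rep (p w))

  below-successor : ∀ {α β} → α ≺ β → (∀ {γ} → α ≺ γ → ¬ γ ≺ β) → below β ≡ size α + below α
  below-successor {α} {β} α≺β nothing-between =
    trans (count-cong (λ w → p w ≺? β) ((λ w → p w ≟ α) ∪? (λ w → p w ≺? α)) (split , merge))
          (count-∪ (λ w → p w ≟ α) (λ w → p w ≺? α) λ { (refl , α≺α) → ≺-irrefl α≺α })
    where
    split : ∀ {w} → p w ≺ β → p w ≡ α ⊎ p w ≺ α
    split {w} pw≺β with ≺-compare (p w) α
    ... | tri< pw≺α _ _ = inj₂ pw≺α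
    ... | tri≈ _ pw≡α _ = inj₁ pw≡α
    ... | tri> _ _ α≺pw = contradiction pw≺β (nothing-between α≺pw)
    merge : ∀ {w} → p w ≡ α ⊎ p w ≺ α → p w ≺ β
    merge (inj₁ pw≡α) = subst (_≺ β) (sym pw≡α) α≺β
    merge (inj₂ pw≺α) = ≺-trans pw≺α α≺β

  parity-gap : ∀ {α β} → size α ≡ 1 → Acc _≺_ β → α ≺ β → parity (below α) ≡ parity (below β) →
               ∃[ γ ] α ≺ γ × γ ≺ β × parity (below γ) ≢ parity (below α)
  parity-gap {α} {β} size≡1 (acc rec) α≺β same-parity with any? (λ γ → (α ≺? γ) ×-dec (γ ≺? β))
  ... | no nothing-between = ⊥-elim (parity-suc (below α) (sym (trans same-parity (cong parity below-β))))
    where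
    below-β : below β ≡ suc (below α)
    below-β = trans (below-successor α≺β (λ α≺γ γ≺β → nothing-between (_ , α≺γ , γ≺β)))
                    (cong (_+ below α) size≡1)
  ... | yes (γ , α≺γ , γ≺β) with parity (below γ) ℙ.≟ parity (below α)
  ...   | no differs = γ , α≺γ , γ≺β , differs
  ...   | yes same with parity-gap size≡1 (rec γ≺β) α≺γ (sym same)
  ...     | δ , α≺δ , δ≺γ , differs = δ , α≺δ , ≺-trans δ≺γ γ≺β , differs

  lowerColour : Fin n → Fin n → Parity
  lowerColour u w with p u ≺? p w
  ... | yes _ = χ u
  ... | no _ = χ w

  lowerColour-≺ : ∀ {u w} → p u ≺ p w → lowerColour u w ≡ χ u
  lowerColour-≺ {u} {w} pu≺pw with p u ≺? p w
  ... | yes _ = refl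
  ... | no pu⊀pw = contradiction pu≺pw pu⊀pw

  lowerColour-≻ : ∀ {u w} → p w ≺ p u → lowerColour u w ≡ χ w
  lowerColour-≻ {u} {w} pw≺pu with p u ≺? p w
  ... | yes pu≺pw = contradiction pu≺pw (≺-asym pw≺pu)
  ... | no _ = refl

  lowerColour-sym : ∀ {u w} → p u ≢ p w → lowerColour u w ≡ lowerColour w u
  lowerColour-sym {u} {w} pu≢pw with ≺-compare (p u) (p w)
  ... | tri< pu≺pw _ _ = trans (lowerColour-≺ pu≺pw) (sym (lowerColour-≻ pu≺pw))
  ... | tri≈ _ pu≡pw _ = contradiction pu≡pw pu≢pw
  ... | tri> _ _ pw≺pu = trans (lowerColour-≻ pw≺pu) (sym (lowerColour-≺ pw≺pu))

  colouring : EdgeColoring (completeMultipartite p) 2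
  colouring = record
    { col     = λ u w → toFin (lowerColour u w)
    ; col-sym = λ u w pu≢pw → cong toFin (lowerColour-sym pu≢pw)
    }

  EdgeOfColour : Parity → Fin n → Pred (Fin n) 0ℓ
  EdgeOfColour c x w = p x ≢ p w × lowerColour x w ≡ c

  edgeOfColour? : ∀ c x → Decidable (EdgeOfColour c x)
  edgeOfColour? c x w = ¬? (p x ≟ p w) ×-dec (lowerColour x w ℙ.≟ c)

  deg : Parity → Fin n → ℕ
  deg c x = count (edgeOfColour? c x)

  colorDegree≡deg : ∀ c x → colorDegree colouring (toFin c) x ≡ deg c x
  colorDegree≡deg c x = trans (length-filter-tabulate edgeOfColourFin? (λ w → w))
    (count-cong edgeOfColourFin? (edgeOfColour? c x)
      ((λ (apart , eq) → apart , toFin-injective eq) , λ (apart , eq) → apart , cong toFin eq))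
    where
    edgeOfColourFin? : ∀ w → Dec (p x ≢ p w × toFin (lowerColour x w) ≡ toFin c)
    edgeOfColourFin? w = ¬? (p x ≟ p w) ×-dec (toFin (lowerColour x w) ≟ toFin c)

  module HigherEndpoint (big : Fin n) (size-big : 2 ≤ size (p big))
                        {i j : Fin n} (α≺β : p i ≺ p j) where

    private
      α β : Fin k
      α = p i
      β = p j
      c : Parity
      c = χ i

    SameColourInα : Pred (Fin n) 0ℓ
    SameColourInα w = p w ≡ α × χ w ≡ c

    AtOrAboveβ : Pred (Fin n) 0ℓ
    AtOrAboveβ w = p w ≡ β ⊎ (β ≺ p w × χ j ≢ c)

    OtherColourBetween : Pred (Fin n) 0ℓ
    OtherColourBetween w = α ≺ p w × p w ≺ β × χ w ≢ c

    sameColourInα? : Decidable SameColourInα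
    sameColourInα? w = (p w ≟ α) ×-dec (χ w ℙ.≟ c)

    atOrAboveβ? : Decidable AtOrAboveβ
    atOrAboveβ? w = (p w ≟ β) ⊎-dec ((β ≺? p w) ×-dec ¬? (χ j ℙ.≟ c))

    otherColourBetween? : Decidable OtherColourBetween
    otherColourBetween? w = (α ≺? p w) ×-dec (p w ≺? β) ×-dec ¬? (χ w ℙ.≟ c)

    private
      A H M : ℕ
      A = count sameColourInα?
      H = count atOrAboveβ?
      M = count otherColourBetween?

    above-α : ∀ {w} → α ≺ p w → EdgeOfColour c i w
    above-α α≺pw = ≺⇒≢ α≺pw , lowerColour-≺ α≺pw

    edge-j : ∀ {w} → EdgeOfColour c j w → EdgeOfColour c i w ⊎ SameColourInα w
    edge-j {w} (β≢pw , colour-c) with ≺-compare (p w) α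
    ... | tri< pw≺α _ _ = inj₁ (≺⇒≢ pw≺α ∘ sym , trans (lowerColour-≻ pw≺α) χw≡c)
      where χw≡c = trans (sym (lowerColour-≻ (≺-trans pw≺α α≺β))) colour-c
    ... | tri≈ _ pw≡α _ = inj₂ (pw≡α , trans (sym (lowerColour-≻ pw≺β)) colour-c)
      where pw≺β = subst (_≺ β) (sym pw≡α) α≺β
    ... | tri> _ _ α≺pw = inj₁ (above-α α≺pw)

    covered : EdgeOfColour c j ∪ (AtOrAboveβ ∪ OtherColourBetween) ⊆ EdgeOfColour c i ∪ SameColourInα
    covered (inj₁ e) = edge-j e
    covered (inj₂ (inj₁ (inj₁ pw≡β))) = inj₁ (above-α (subst (α ≺_) (sym pw≡β) α≺β))
    covered (inj₂ (inj₁ (inj₂ (β≺pw , _)))) = inj₁ (above-α (≺-trans α≺β β≺pw))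
    covered (inj₂ (inj₂ (α≺pw , _))) = inj₁ (above-α α≺pw)

    balance : deg c j + (H + M) ≤ deg c i + A
    balance = begin
      deg c j + (H + M)
        ≡⟨ cong (deg c j +_) (count-∪ atOrAboveβ? otherColourBetween? H⊥M) ⟨
      deg c j + count (atOrAboveβ? ∪? otherColourBetween?)
        ≡⟨ count-∪ (edgeOfColour? c j) (atOrAboveβ? ∪? otherColourBetween?) Eⱼ⊥H∪M ⟨
      count (edgeOfColour? c j ∪? (atOrAboveβ? ∪? otherColourBetween?))
        ≤⟨ count-mono (edgeOfColour? c j ∪? (atOrAboveβ? ∪? otherColourBetween?))
                      (edgeOfColour? c i ∪? sameColourInα?) covered ⟩
      count (edgeOfColour? c i ∪? sameColourInα?)
        ≡⟨ count-∪ (edgeOfColour? c i) sameColourInα? Eᵢ⊥A ⟩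
      deg c i + A ∎
      where
      open ≤-Reasoning
      H⊥M : AtOrAboveβ ⊥ OtherColourBetween
      H⊥M (inj₁ pw≡β , _ , pw≺β , _) = ≺⇒≢ pw≺β pw≡β
      H⊥M (inj₂ (β≺pw , _) , _ , pw≺β , _) = ≺-asym β≺pw pw≺β
      Eⱼ⊥H∪M : EdgeOfColour c j ⊥ (AtOrAboveβ ∪ OtherColourBetween)
      Eⱼ⊥H∪M ((β≢pw , _) , inj₁ (inj₁ pw≡β)) = β≢pw (sym pw≡β)
      Eⱼ⊥H∪M ((_ , colour-c) , inj₁ (inj₂ (β≺pw , χj≢c))) = χj≢c (trans (sym (lowerColour-≺ β≺pw)) colour-c)
      Eⱼ⊥H∪M ((_ , colour-c) , inj₂ (_ , pw≺β , χw≢c)) = χw≢c (trans (sym (lowerColour-≻ pw≺β)) colour-c)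
      Eᵢ⊥A : EdgeOfColour c i ⊥ SameColourInα
      Eᵢ⊥A ((α≢pw , _) , pw≡α , _) = α≢pw (sym pw≡α)

    private
      A≤size-α : A ≤ size α
      A≤size-α = count-mono sameColourInα? (λ w → p w ≟ α) proj₁

      size-β≤H : size β ≤ H
      size-β≤H = count-mono (λ w → p w ≟ β) atOrAboveβ? inj₁

    two≤H : size β ≤ 1 → χ j ≢ c → 2 ≤ H
    two≤H size-β≤1 χj≢c = count-≥2 atOrAboveβ? j≢big (inj₁ refl) (inj₂ (β≺big , χj≢c))
      where
      β≺big : β ≺ p big
      β≺big = inj₁ (≤-<-trans size-β≤1 size-big)
      j≢big : j ≢ big
      j≢big j≡big = ≺⇒≢ β≺big (cong p j≡big)

    one≤M : size α ≡ 1 → size β ≡ 1 → χ j ≡ c → 1 ≤ M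
    one≤M size-α≡1 size-β≡1 χj≡c with parity-gap size-α≡1 (≺-wellFounded β) α≺β same-parity
      where
      same-parity : parity (below α) ≡ parity (below β)
      same-parity = ⁻¹-injective
        (trans (sym (χ-singleton size-α≡1)) (trans (sym χj≡c) (χ-singleton size-β≡1)))
    ... | γ , α≺γ , γ≺β , γ-differs = count-≥1 otherColourBetween? {rep γ}
      ( subst (α ≺_) (sym (p∘rep γ)) α≺γ
      , subst (_≺ β) (sym (p∘rep γ)) γ≺β
      , λ χγ≡c → γ-differs (⁻¹-injective (trans (sym (χ-rep γ)) (trans χγ≡c (χ-singleton size-α≡1)))))

    two≤H+M : size α ≡ 1 → 2 ≤ H + M
    two≤H+M size-α≡1 with size β ≤? 1
    ... | no size-β≰1 = ≤-trans (≰⇒> size-β≰1) (≤-trans size-β≤H (m≤m+n H M))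
    ... | yes size-β≤1 = case χ j ℙ.≟ c of λ where
      (no χj≢c)  → ≤-trans (two≤H size-β≤1 χj≢c) (m≤m+n H M)
      (yes χj≡c) → +-mono-≤ (count-≥1 atOrAboveβ? {j} (inj₁ refl))
                            (one≤M size-α≡1 (≤-antisym size-β≤1 (count-≥1 (λ w → p w ≟ β) {j} refl)) χj≡c)

    A<H+M : A < H + M
    A<H+M with any? (λ w → (p w ≟ α) ×-dec ¬? (χ w ℙ.≟ c))
    ... | yes (w , pw≡α , χw≢c) =
      <-≤-trans (count-< sameColourInα? (λ v → p v ≟ α) proj₁ (χw≢c ∘ proj₂) pw≡α)
                (≤-trans (size-mono α≺β) (≤-trans size-β≤H (m≤m+n H M)))
    ... | no no-other-colour = ≤-<-trans (subst (A ≤_) size-α≡1 A≤size-α) (two≤H+M size-α≡1)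
      where
      size-α≡1 : size α ≡ 1
      size-α≡1 = monochromatic⇒singleton λ {w} pw≡α →
        decidable-stable (χ w ℙ.≟ c) (λ χw≢c → no-other-colour (w , pw≡α , χw≢c))

    deg-higher<deg-lower : deg c j < deg c i
    deg-higher<deg-lower = ≰⇒> λ i≤j →
      <-irrefl refl (<-≤-trans (+-mono-≤-< i≤j A<H+M) balance)

  irregular-edge : (big : Fin n) → 2 ≤ size (p big) → ∀ {u v} → p u ≺ p v →
    colorDegree colouring (toFin (lowerColour u v)) u ≢ colorDegree colouring (toFin (lowerColour u v)) v
  irregular-edge big size-big {u} {v} pu≺pv
    rewrite lowerColour-≺ pu≺pv | colorDegree≡deg (χ u) u | colorDegree≡deg (χ u) v =
    >⇒≢ (HigherEndpoint.deg-higher<deg-lower big size-big pu≺pv)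

  locallyIrregular : (big : Fin n) → 2 ≤ size (p big) → LocallyIrregular colouring
  locallyIrregular big size-big u v pu≢pv with ≺-compare (p u) (p v)
  ... | tri< pu≺pv _ _ = irregular-edge big size-big pu≺pv
  ... | tri≈ _ pu≡pv _ = contradiction pu≡pv pu≢pv
  ... | tri> _ _ pv≺pu rewrite lowerColour-sym pu≢pv = ≢-sym (irregular-edge big size-big pv≺pu)

non-injective⇒collision : ∀ {k} (f : Fin n → Fin k) → ¬ Injective _≡_ _≡_ f →
                          ∃[ x ] ∃[ y ] x ≢ y × f x ≡ f y
non-injective⇒collision f not-injective with any? (λ x → any? (λ y → ¬? (x ≟ y) ×-dec (f x ≟ f y)))
... | yes collision = collision
... | no no-collision = ⊥-elim (not-injective injective)
  where
  injective : Injective _≡_ _≡_ f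
  injective {x} {y} fx≡fy = decidable-stable (x ≟ y) (λ x≢y → no-collision (x , y , x≢y , fx≡fy))

mainTheorem7 : (k n : ℕ) → k ≥ 2 → (p : Fin n → Fin k) →
    Surjective _≡_ _≡_ p → ¬ Injective _≡_ _≡_ p →
    lirAtMost (completeMultipartite p) 2
mainTheorem7 k n _ p surjective not-injective with non-injective⇒collision p not-injective
... | x , y , x≢y , px≡py =
  colouring , locallyIrregular x (count-≥2 (λ w → p w ≟ p x) x≢y refl (sym px≡py))
  where
  open Construction p (λ α → proj₁ (surjective α)) (λ α → proj₂ (surjective α) refl)
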